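{- Let $G$ be a finite abstract simplicial complex with connection graph $G'$ and Barycentric refinement graph $G_1$. For every face $x \in G$, $$ d_{G'}(x) = \sum_{y \in B_{G'}(x)} \chi(S^+(y)), $$ where $d_{G'}(x)$ is the vertex degree of $x$ in $G'$, $B_{G'}(x)$ is the unit ball of $x$ in $G'$ (the set consisting of $x$ and all faces adjacent to $x$ in $G'$), and $S^+(y)$ is the subgraph of $G_1$ induced by the faces $z\in G$ with $y \subsetneq z$.
   Context: A finite abstract simplicial complex $G$ is a finite collection of non-empty finite sets (faces) closed under taking non-empty subsets. The connection graph $G'$ has vertex set $G$, two distinct faces adjacent iff they intersect. The Barycentric refinement $G_1$ has vertex set $G$, two distinct faces adjacent iff one contains the other. For a finite simple graph $H$, $\chi(H)=\sum_{k\ge 0}(-1)^k c_{k+1}(H)$ where $c_{k+1}(H)$ is the number of complete subgraphs with $k+1$ vertices; the empty graph has $\chi=0$. -}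

module Defs where

open import Data.Nat using (ℕ; suc; _∸_)
open import Data.Bool using (Bool)
import Data.Bool as Bool
open import Data.Fin.Subset using (Subset; _⊆_; _⊂_; _∩_; Nonempty)
open import Data.Fin.Subset.Properties using (_⊆?_; _⊂?_; nonempty?)
open import Data.Vec.Properties using (≡-dec)
open import Data.List using (List; []; _∷_; _++_; map; filter; length)
open import Data.List.Membership.Propositional using (_∈_)
open import Data.List.Relation.Unary.All using (All)
open import Data.List.Relation.Unary.Unique.Propositional using (Unique)
open import Data.List.Relation.Unary.AllPairs using (AllPairs; allPairs?)
open import Data.Integer using (ℤ; +_; -_; _+_; 0ℤ)
open import Data.Sum using (_⊎_)
open import Data.Product using (_×_)
open import Relation.Binary.PropositionalEquality using (_≡_)
open import Relation.Nullary using (Dec; ¬_; yes; no)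
open import Relation.Nullary.Decidable using (_⊎-dec_; _×-dec_; ¬?)
open import Relation.Binary using (Decidable)

record Complex (n : ℕ) : Set where
  field
    faces    : List (Subset n)
    unique   : Unique faces
    nonempty : All Nonempty faces
    closed   : ∀ {x y : Subset n} → x ∈ faces → Nonempty y → y ⊆ x → y ∈ faces
open Complex public

-- Finite simple graphs given by a duplicate-free vertex list and a
-- decidable adjacency relation (only used on distinct vertices).

-- all sub-lists (subsequences) of a list; for a duplicate-free list these
-- correspond bijectively to the subsets of its set of elements
sublists : ∀ {A : Set} → List A → List (List A)
sublists []       = [] ∷ []
sublists (x ∷ xs) = sublists xs ++ map (x ∷_) (sublists xs)

sgn : ℕ → ℤ
sgn 0       = + 1
sgn (suc k) = - sgn k

sumℤ : List ℤ → ℤ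
sumℤ []       = 0ℤ
sumℤ (x ∷ xs) = x + sumℤ xs

cliques : ∀ {A : Set} {R : A → A → Set} → Decidable R → List A → List (List A)
cliques R? V = filter (λ c → allPairs? R? c) (filter (λ c → nonemptyL? c) (sublists V))
  where
    nonemptyL? : ∀ {A : Set} (c : List A) → Dec (¬ (c ≡ []))
    nonemptyL? []      = no (λ f → f Relation.Binary.PropositionalEquality.refl)
    nonemptyL? (_ ∷ _) = yes (λ ())

χ : ∀ {A : Set} {R : A → A → Set} → Decidable R → List A → ℤ
χ R? V = sumℤ (map (λ c → sgn (length c ∸ 1)) (cliques R? V))

_≟ˢ_ : ∀ {n} → Decidable {A = Subset n} _≡_
_≟ˢ_ = ≡-dec Bool._≟_

-- adjacency in the Barycentric refinement G₁: one face strictly contains the other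
Comparable : ∀ {n} → Subset n → Subset n → Set
Comparable x y = x ⊂ y ⊎ y ⊂ x

comparable? : ∀ {n} → Decidable (Comparable {n})
comparable? x y = (x ⊂? y) ⊎-dec (y ⊂? x)

-- adjacency in the connection graph G': distinct faces that intersect
Connected : ∀ {n} → Subset n → Subset n → Set
Connected x y = ¬ (x ≡ y) × Nonempty (x ∩ y)

connected? : ∀ {n} → Decidable (Connected {n})
connected? x y = ¬? (x ≟ˢ y) ×-dec nonempty? (x ∩ y)

degree' : ∀ {n} → Complex n → Subset n → ℕ
degree' G x = length (filter (connected? x) (faces G))

ball' : ∀ {n} → Complex n → Subset n → List (Subset n)
ball' G x = filter (λ y → (y ≟ˢ x) ⊎-dec connected? x y) (faces G)

starVerts : ∀ {n} → Complex n → Subset n → List (Subset n)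
starVerts G y = filter (y ⊂?_) (faces G)

χS⁺ : ∀ {n} → Complex n → Subset n → ℤ
χS⁺ G y = χ comparable? (starVerts G y)

-- Write f(y) = χ(S⁺(y)). Sorting the chains of the poset S⁺(y) by their least element gives
-- f(y) = Σ_{w ⊋ y} (1 − f(w)), so that Σ_{y ⊇ s} f(y) is the number of faces strictly
-- containing s. By inclusion–exclusion over the non-empty s ⊆ x, each of them a face,
-- Σ_{y ∈ B(x)} f(y) = Σ_s (−1)^{|s|+1} #{y ⊋ s}, and the same computation with f replaced
-- by 1 gives 1 + d(x) = Σ_s (−1)^{|s|+1} (1 + #{y ⊋ s}), where Σ_s (−1)^{|s|+1} = 1.
module Submission where

open import Defs
open import Data.Bool using (if_then_else_)
open import Data.Fin using (zero; suc)
open import Data.Fin.Subset using (Subset; _⊆_; _∩_; Nonempty; inside; outside)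
open import Data.Fin.Subset.Properties
  using (_⊆?_; _⊂?_; nonempty?; out⊆; s⊆s; ∩-idem; ⊂-isStrictPartialOrder)
open import Data.Integer using (ℤ; +_; -_; _+_; _-_; _*_; 0ℤ; 1ℤ)
import Data.Integer.Properties as ℤ
open import Data.Integer.Tactic.RingSolver using (solve-∀)
open import Data.List using (List; []; _∷_; _++_; map; filter; length)
open import Data.List.Properties using (filter-≐; filter-reject; length-filter)
open import Data.List.Membership.Propositional using (_∈_)
open import Data.List.Membership.Propositional.Properties using (∈-map⁻; ∈-++⁻)
open import Data.List.Relation.Unary.Any using (here; there)
open import Data.List.Relation.Unary.All using (all?; lookup)
open import Data.List.Relation.Unary.AllPairs using (allPairs?; _∷_)
open import Data.List.Relation.Unary.Unique.Propositional using (Unique)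
open import Data.Nat using (ℕ; suc; _≤_; s≤s; _∸_)
import Data.Nat.Properties as ℕ
open import Data.Product using (_,_; proj₁; swap)
open import Data.Sum using (_⊎_; inj₁; inj₂)
open import Data.Vec using ([]; _∷_; here; there)
open import Function using (_∘′_)
open import Relation.Binary using (Decidable; DecidableEquality; IsStrictPartialOrder)
open import Relation.Binary.PropositionalEquality
open import Relation.Nullary using (Dec; does; yes; no; ¬_; contradiction)
open import Relation.Nullary.Decidable using (dec-true; dec-false; _⊎-dec_; _×-dec_)
open import Relation.Unary as U using (Pred)
open import Relation.Unary.Properties using (_∩?_)

𝟙 : ∀ {p} {P : Set p} → Dec P → ℤ
𝟙 d = if does d then 1ℤ else 0ℤ

module _ {p} {P : Set p} (d : Dec P) where

  𝟙≡1 : P → 𝟙 d ≡ 1ℤ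
  𝟙≡1 x = cong (λ b → if b then 1ℤ else 0ℤ) (dec-true d x)

  𝟙≡0 : ¬ P → 𝟙 d ≡ 0ℤ
  𝟙≡0 ¬x = cong (λ b → if b then 1ℤ else 0ℤ) (dec-false d ¬x)

𝟙*-cong : ∀ {p} {P : Set p} (d : Dec P) {a b} → (P → a ≡ b) → 𝟙 d * a ≡ 𝟙 d * b
𝟙*-cong (yes x) a≡b = cong (1ℤ *_) (a≡b x)
𝟙*-cong (no _)  a≡b = refl

𝟙-×-dec : ∀ {p q} {P : Set p} {Q : Set q} (d : Dec P) (e : Dec Q) → 𝟙 (d ×-dec e) ≡ 𝟙 d * 𝟙 e
𝟙-×-dec (yes _) (yes _) = refl
𝟙-×-dec (yes _) (no _)  = refl
𝟙-×-dec (no _)  _       = refl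

𝟙-⇔ : ∀ {p q} {P : Set p} {Q : Set q} → (P → Q) → (Q → P) →
      (d : Dec P) (e : Dec Q) → 𝟙 d ≡ 𝟙 e
𝟙-⇔ P→Q Q→P d (yes q) = 𝟙≡1 d (Q→P q)
𝟙-⇔ P→Q Q→P d (no ¬q) = 𝟙≡0 d (λ x → ¬q (P→Q x))

module _ {A : Set} where

  filter-filter : ∀ {p q} {P : Pred A p} {Q : Pred A q}
                  (P? : U.Decidable P) (Q? : U.Decidable Q) xs →
                  filter P? (filter Q? xs) ≡ filter (P? ∩? Q?) xs
  filter-filter P? Q? []       = refl
  filter-filter P? Q? (x ∷ xs) with Q? x
  ... | yes _ with P? x
  ...   | yes _ = cong (x ∷_) (filter-filter P? Q? xs)
  ...   | no _  = filter-filter P? Q? xs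
  filter-filter P? Q? (x ∷ xs) | no _ with P? x
  ...   | yes _ = filter-filter P? Q? xs
  ...   | no _  = filter-filter P? Q? xs

  filter-⊆ : ∀ {p q} {P : Pred A p} {Q : Pred A q}
             (P? : U.Decidable P) (Q? : U.Decidable Q) →
             (∀ {x} → P x → Q x) → ∀ xs → filter P? (filter Q? xs) ≡ filter P? xs
  filter-⊆ P? Q? P⇒Q xs =
    trans (filter-filter P? Q? xs) (filter-≐ (P? ∩? Q?) P? (proj₁ , λ x → x , P⇒Q x) xs)

  filter-comm : ∀ {p q} {P : Pred A p} {Q : Pred A q}
                (P? : U.Decidable P) (Q? : U.Decidable Q) →
                ∀ xs → filter P? (filter Q? xs) ≡ filter Q? (filter P? xs)
  filter-comm P? Q? xs = begin
      filter P? (filter Q? xs)   ≡⟨ filter-filter P? Q? xs ⟩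
      filter (P? ∩? Q?) xs       ≡⟨ filter-≐ (P? ∩? Q?) (Q? ∩? P?) (swap , swap) xs ⟩
      filter (Q? ∩? P?) xs       ≡⟨ filter-filter Q? P? xs ⟨
      filter Q? (filter P? xs)   ∎
    where open ≡-Reasoning

module _ {A : Set} where

  ∑ : List A → (A → ℤ) → ℤ
  ∑ L g = sumℤ (map g L)

  ∑-++ : ∀ xs ys g → ∑ (xs ++ ys) g ≡ ∑ xs g + ∑ ys g
  ∑-++ []       ys g = sym (ℤ.+-identityˡ _)
  ∑-++ (x ∷ xs) ys g = trans (cong (_+_ (g x)) (∑-++ xs ys g)) (sym (ℤ.+-assoc (g x) _ _))

  ∑-cong : ∀ L {g h : A → ℤ} → (∀ {y} → y ∈ L → g y ≡ h y) → ∑ L g ≡ ∑ L h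
  ∑-cong []      g≡h = refl
  ∑-cong (x ∷ L) g≡h = cong₂ _+_ (g≡h (here refl)) (∑-cong L (g≡h ∘′ there))

  ∑-zero : ∀ L → ∑ L (λ _ → 0ℤ) ≡ 0ℤ
  ∑-zero []      = refl
  ∑-zero (x ∷ L) = trans (ℤ.+-identityˡ _) (∑-zero L)

  ∑-+ : ∀ L g h → ∑ L (λ y → g y + h y) ≡ ∑ L g + ∑ L h
  ∑-+ []      g h = refl
  ∑-+ (x ∷ L) g h = trans (cong (_+_ (g x + h x)) (∑-+ L g h)) (interchange (g x) (h x) _ _)
    where
      interchange : ∀ a b c d → a + b + (c + d) ≡ a + c + (b + d)
      interchange = solve-∀

  ∑-neg : ∀ L g → ∑ L (λ y → - g y) ≡ - ∑ L g
  ∑-neg []      g = refl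
  ∑-neg (x ∷ L) g = trans (cong (_+_ (- g x)) (∑-neg L g)) (sym (ℤ.neg-distrib-+ (g x) _))

  ∑-- : ∀ L g h → ∑ L (λ y → g y - h y) ≡ ∑ L g - ∑ L h
  ∑-- L g h = trans (∑-+ L g (λ y → - h y)) (cong (_+_ (∑ L g)) (∑-neg L h))

  ∑-*ˡ : ∀ L c g → ∑ L (λ y → c * g y) ≡ c * ∑ L g
  ∑-*ˡ []      c g = sym (ℤ.*-zeroʳ c)
  ∑-*ˡ (x ∷ L) c g = trans (cong (_+_ (c * g x)) (∑-*ˡ L c g)) (sym (ℤ.*-distribˡ-+ c (g x) _))

  ∑-*ʳ : ∀ L g c → ∑ L g * c ≡ ∑ L (λ y → g y * c)
  ∑-*ʳ []      g c = refl
  ∑-*ʳ (x ∷ L) g c = trans (ℤ.*-distribʳ-+ c (g x) _) (cong (_+_ (g x * c)) (∑-*ʳ L g c))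

  ∑-filter : ∀ {p} {P : Pred A p} (P? : U.Decidable P) L g →
             ∑ (filter P? L) g ≡ ∑ L (λ y → 𝟙 (P? y) * g y)
  ∑-filter P? []      g = refl
  ∑-filter P? (x ∷ L) g with P? x
  ... | yes _ = cong₂ _+_ (sym (ℤ.*-identityˡ (g x))) (∑-filter P? L g)
  ... | no _  = trans (∑-filter P? L g) (sym (ℤ.+-identityˡ _))

  length-filter≡∑ : ∀ {p} {P : Pred A p} (P? : U.Decidable P) L →
                    + length (filter P? L) ≡ ∑ L (λ y → 𝟙 (P? y))
  length-filter≡∑ P? []      = refl
  length-filter≡∑ P? (x ∷ L) with P? x
  ... | yes _ = trans (sym (ℤ.pos-+ 1 _)) (cong (_+_ 1ℤ) (length-filter≡∑ P? L))
  ... | no _  = trans (length-filter≡∑ P? L) (sym (ℤ.+-identityˡ _))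

  ∑-sift : (_≟_ : DecidableEquality A) {L : List A} → Unique L → ∀ {x} → x ∈ L →
           (g : A → ℤ) → ∑ L (λ y → 𝟙 (x ≟ y) * g y) ≡ g x
  ∑-sift _≟_ {x ∷ L} (x∉L ∷ _) (here refl) g = begin
      𝟙 (x ≟ x) * g x + ∑ L (λ y → 𝟙 (x ≟ y) * g y)
    ≡⟨ cong₂ _+_ (cong (_* g x) (𝟙≡1 (x ≟ x) refl))
                 (∑-cong L (λ y∈L → cong (_* _) (𝟙≡0 (x ≟ _) (lookup x∉L y∈L)))) ⟩
      1ℤ * g x + ∑ L (λ _ → 0ℤ)
    ≡⟨ cong₂ _+_ (ℤ.*-identityˡ (g x)) (∑-zero L) ⟩
      g x + 0ℤ
    ≡⟨ ℤ.+-identityʳ (g x) ⟩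
      g x ∎
    where open ≡-Reasoning
  ∑-sift _≟_ {y ∷ L} (y∉L ∷ L!) {x} (there x∈L) g =
    trans (cong (λ c → c * g y + _) (𝟙≡0 (x ≟ y) (λ { refl → lookup y∉L x∈L refl })))
          (trans (ℤ.+-identityˡ _) (∑-sift _≟_ L! x∈L g))

module _ {A B : Set} where

  ∑-map : ∀ (f : A → B) L g → ∑ (map f L) g ≡ ∑ L (λ y → g (f y))
  ∑-map f []      g = refl
  ∑-map f (x ∷ L) g = cong (_+_ (g (f x))) (∑-map f L g)

  ∑-comm : ∀ (L : List A) (M : List B) (k : A → B → ℤ) →
           ∑ L (λ y → ∑ M (k y)) ≡ ∑ M (λ s → ∑ L (λ y → k y s))
  ∑-comm []      M k = sym (∑-zero M)
  ∑-comm (x ∷ L) M k = trans (cong (_+_ (∑ M (k x))) (∑-comm L M k)) (sym (∑-+ M (k x) _))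

module _ {A : Set} where

  isNil : List A → ℤ
  isNil []      = 1ℤ
  isNil (_ ∷ _) = 0ℤ

  ∑-sublists-∷ : ∀ (x : A) V g →
    ∑ (sublists (x ∷ V)) g ≡ ∑ (sublists V) g + ∑ (sublists V) (λ c → g (x ∷ c))
  ∑-sublists-∷ x V g =
    trans (∑-++ (sublists V) _ g) (cong (_+_ (∑ (sublists V) g)) (∑-map (x ∷_) (sublists V) g))

  ∑-sublists-isNil : ∀ V → ∑ (sublists V) isNil ≡ 1ℤ
  ∑-sublists-isNil []      = refl
  ∑-sublists-isNil (x ∷ V) =
    trans (∑-sublists-∷ x V isNil) (cong₂ _+_ (∑-sublists-isNil V) (∑-zero (sublists V)))

  ∑-sublists-filter : ∀ {p} {P : Pred A p} (P? : U.Decidable P) V g →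
    ∑ (sublists (filter P? V)) g ≡ ∑ (sublists V) (λ c → 𝟙 (all? P? c) * g c)
  ∑-sublists-filter P? []      g = cong (_+ 0ℤ) (sym (ℤ.*-identityˡ (g [])))
  ∑-sublists-filter P? (x ∷ V) g = begin
      ∑ (sublists (filter P? (x ∷ V))) g
    ≡⟨ split-head ⟩
      ∑ (sublists (filter P? V)) g + 𝟙 (P? x) * ∑ (sublists (filter P? V)) (λ c → g (x ∷ c))
    ≡⟨ cong₂ _+_ (∑-sublists-filter P? V g)
                 (cong (𝟙 (P? x) *_) (∑-sublists-filter P? V (λ c → g (x ∷ c)))) ⟩
      ∑ (sublists V) weight + 𝟙 (P? x) * ∑ (sublists V) (λ c → 𝟙 (all? P? c) * g (x ∷ c))
    ≡⟨ cong (_+_ (∑ (sublists V) weight))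
            (trans (∑-cong (sublists V) (λ {c} _ → weight-∷ c)) (∑-*ˡ (sublists V) (𝟙 (P? x)) _)) ⟨
      ∑ (sublists V) weight + ∑ (sublists V) (λ c → weight (x ∷ c))
    ≡⟨ ∑-sublists-∷ x V weight ⟨
      ∑ (sublists (x ∷ V)) weight ∎
    where
      open ≡-Reasoning
      weight : List A → ℤ
      weight c = 𝟙 (all? P? c) * g c
      split-head : ∑ (sublists (filter P? (x ∷ V))) g
                   ≡ ∑ (sublists (filter P? V)) g + 𝟙 (P? x) * ∑ (sublists (filter P? V)) (λ c → g (x ∷ c))
      split-head with P? x
      ... | yes _ = trans (∑-sublists-∷ x (filter P? V) g)
                          (cong (_+_ (∑ (sublists (filter P? V)) g)) (sym (ℤ.*-identityˡ _)))
      ... | no _  = sym (ℤ.+-identityʳ _)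
      weight-∷ : ∀ c → weight (x ∷ c) ≡ 𝟙 (P? x) * (𝟙 (all? P? c) * g (x ∷ c))
      weight-∷ c = trans (cong (_* g (x ∷ c)) (𝟙-×-dec (P? x) (all? P? c)))
                         (ℤ.*-assoc (𝟙 (P? x)) (𝟙 (all? P? c)) (g (x ∷ c)))

module _ {A : Set} {R : A → A → Set} (R? : Decidable R) where

  signedCliques : List A → ℤ
  signedCliques V = ∑ (filter (allPairs? R?) (sublists V)) (λ c → sgn (length c))

  -- The decision procedure by which `cliques` discards [] is local to its definition,
  -- so it is abstracted here as any decidable predicate rejecting exactly [].
  private
    ∑-nonempty-cliques : ∀ {p} {NE : Pred (List A) p} (NE? : U.Decidable NE) →
      ¬ NE [] → (∀ x xs → NE (x ∷ xs)) → ∀ Ls →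
      ∑ (filter (allPairs? R?) (filter NE? Ls)) (λ c → sgn (length c ∸ 1))
        ≡ ∑ Ls isNil - ∑ (filter (allPairs? R?) Ls) (λ c → sgn (length c))
    ∑-nonempty-cliques NE? ¬NE[] NE∷ Ls = begin
        ∑ (filter (allPairs? R?) (filter NE? Ls)) (λ c → sgn (length c ∸ 1))
      ≡⟨ ∑-filter (allPairs? R?) (filter NE? Ls) _ ⟩
        ∑ (filter NE? Ls) (λ c → 𝟙 (allPairs? R? c) * sgn (length c ∸ 1))
      ≡⟨ ∑-filter NE? Ls _ ⟩
        ∑ Ls (λ c → 𝟙 (NE? c) * (𝟙 (allPairs? R? c) * sgn (length c ∸ 1)))
      ≡⟨ ∑-cong Ls (λ {c} _ → pointwise c) ⟩
        ∑ Ls (λ c → isNil c - 𝟙 (allPairs? R? c) * sgn (length c))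
      ≡⟨ ∑-- Ls isNil _ ⟩
        ∑ Ls isNil - ∑ Ls (λ c → 𝟙 (allPairs? R? c) * sgn (length c))
      ≡⟨ cong (_-_ (∑ Ls isNil)) (∑-filter (allPairs? R?) Ls _) ⟨
        ∑ Ls isNil - ∑ (filter (allPairs? R?) Ls) (λ c → sgn (length c)) ∎
      where
        open ≡-Reasoning
        flip-sign : ∀ a s → 1ℤ * (a * s) ≡ 0ℤ - a * - s
        flip-sign = solve-∀
        pointwise : ∀ c → 𝟙 (NE? c) * (𝟙 (allPairs? R? c) * sgn (length c ∸ 1))
                          ≡ isNil c - 𝟙 (allPairs? R? c) * sgn (length c)
        pointwise []       = cong (_* 1ℤ) (𝟙≡0 (NE? []) ¬NE[])
        pointwise (x ∷ xs) = trans (cong (_* _) (𝟙≡1 (NE? (x ∷ xs)) (NE∷ x xs)))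
                                   (flip-sign (𝟙 (allPairs? R? (x ∷ xs))) (sgn (length xs)))

  χ≡1-signedCliques : ∀ V → χ R? V ≡ 1ℤ - signedCliques V
  χ≡1-signedCliques V =
    trans (∑-nonempty-cliques _ (λ ¬[]≡[] → ¬[]≡[] refl) (λ _ _ ()) (sublists V))
          (cong (_- signedCliques V) (∑-sublists-isNil V))

  signedCliques-∷ : ∀ v V →
    signedCliques (v ∷ V) ≡ signedCliques V - signedCliques (filter (R? v) V)
  signedCliques-∷ v V = begin
      signedCliques (v ∷ V)
    ≡⟨ ∑-filter (allPairs? R?) (sublists (v ∷ V)) sgnLength ⟩
      ∑ (sublists (v ∷ V)) weight
    ≡⟨ ∑-sublists-∷ v V weight ⟩
      ∑ (sublists V) weight + ∑ (sublists V) (λ c → weight (v ∷ c))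
    ≡⟨ cong₂ _+_ (∑-filter (allPairs? R?) (sublists V) sgnLength)
                 (∑-cong (sublists V) (λ {c} _ → weight-∷ c)) ⟨
      signedCliques V + ∑ (sublists V) (λ c → - (𝟙 (all? (R? v) c) * weight c))
    ≡⟨ cong (_+_ (signedCliques V)) (∑-neg (sublists V) _) ⟩
      signedCliques V - ∑ (sublists V) (λ c → 𝟙 (all? (R? v) c) * weight c)
    ≡⟨ cong (_-_ (signedCliques V)) (∑-sublists-filter (R? v) V weight) ⟨
      signedCliques V - ∑ (sublists (filter (R? v) V)) weight
    ≡⟨ cong (_-_ (signedCliques V)) (∑-filter (allPairs? R?) (sublists (filter (R? v) V)) sgnLength) ⟨
      signedCliques V - signedCliques (filter (R? v) V) ∎
    where
      open ≡-Reasoning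
      sgnLength : List A → ℤ
      sgnLength c = sgn (length c)
      weight : List A → ℤ
      weight c = 𝟙 (allPairs? R? c) * sgnLength c
      reassoc : ∀ a b s → a * b * - s ≡ - (a * (b * s))
      reassoc = solve-∀
      weight-∷ : ∀ c → - (𝟙 (all? (R? v) c) * weight c) ≡ weight (v ∷ c)
      weight-∷ c = sym (trans (cong (_* - sgnLength c) (𝟙-×-dec (all? (R? v) c) (allPairs? R? c)))
                              (reassoc (𝟙 (all? (R? v) c)) (𝟙 (allPairs? R? c)) (sgnLength c)))

-- Order complexes

module OrderComplex {A : Set} {_<_ : A → A → Set}
  (isStrictPartialOrder : IsStrictPartialOrder _≡_ _<_) (_<?_ : Decidable _<_) where

  open IsStrictPartialOrder isStrictPartialOrder
    using () renaming (irrefl to <-irrefl; trans to <-trans; asym to <-asym)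

  _≶?_ : Decidable (λ x y → x < y ⊎ y < x)
  x ≶? y = (x <? y) ⊎-dec (y <? x)

  above : List A → A → List A
  above V w = filter (w <?_) V

  𝟙-≶? : ∀ v w → 𝟙 (v ≶? w) ≡ 𝟙 (v <? w) + 𝟙 (w <? v)
  𝟙-≶? v w with v <? w | w <? v
  ... | yes v<w | yes w<v = contradiction w<v (<-asym v<w)
  ... | yes _   | no _    = refl
  ... | no _    | yes _   = refl
  ... | no _    | no _    = refl

  above-above : ∀ {v w} → v < w → ∀ V → above (above V v) w ≡ above V w
  above-above v<w = filter-⊆ (_ <?_) (_ <?_) (<-trans v<w)

  above-comparable : ∀ {v w} → v < w → ∀ V → above (filter (v ≶?_) V) w ≡ above V w
  above-comparable v<w = filter-⊆ (_ <?_) (_ ≶?_) (λ w<u → inj₁ (<-trans v<w w<u))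

  private
    X : List A → ℤ
    X = signedCliques _≶?_

    -- Every chain of V is its least element w followed by a chain of `above V w`.
    ChainsByMinimum : List A → Set
    ChainsByMinimum V = 1ℤ - X V ≡ ∑ V (λ w → X (above V w))

    below : A → List A → ℤ
    below v V = ∑ V (λ w → 𝟙 (w <? v) * X (filter (v ≶?_) (above V w)))

    X-above-∷ : ∀ v V w →
      X (above (v ∷ V) w) ≡ X (above V w) - 𝟙 (w <? v) * X (filter (v ≶?_) (above V w))
    X-above-∷ v V w with w <? v
    ... | yes _ = trans (signedCliques-∷ _≶?_ v (above V w))
                        (cong (_-_ (X (above V w))) (sym (ℤ.*-identityˡ _)))
    ... | no _  = sym (ℤ.+-identityʳ _)

    X-above-comparable : ∀ v V w →
      𝟙 (v ≶? w) * X (above (filter (v ≶?_) V) w)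
        ≡ 𝟙 (v <? w) * X (above (above V v) w) + 𝟙 (w <? v) * X (filter (v ≶?_) (above V w))
    X-above-comparable v V w = begin
        𝟙 (v ≶? w) * X (above (filter (v ≶?_) V) w)
      ≡⟨ cong (_* X (above (filter (v ≶?_) V) w)) (𝟙-≶? v w) ⟩
        (𝟙 (v <? w) + 𝟙 (w <? v)) * X (above (filter (v ≶?_) V) w)
      ≡⟨ ℤ.*-distribʳ-+ _ (𝟙 (v <? w)) (𝟙 (w <? v)) ⟩
        𝟙 (v <? w) * X (above (filter (v ≶?_) V) w) + 𝟙 (w <? v) * X (above (filter (v ≶?_) V) w)
      ≡⟨ cong₂ _+_ (𝟙*-cong (v <? w) (λ v<w → cong X (trans (above-comparable v<w V)
                                                             (sym (above-above v<w V)))))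
                   (cong (λ W → 𝟙 (w <? v) * X W) (filter-comm (w <?_) (v ≶?_) V)) ⟩
        𝟙 (v <? w) * X (above (above V v) w) + 𝟙 (w <? v) * X (filter (v ≶?_) (above V w)) ∎
      where open ≡-Reasoning

    X-comparable : ∀ v V → ChainsByMinimum (filter (v ≶?_) V) → ChainsByMinimum (above V v) →
                   X (filter (v ≶?_) V) ≡ X (above V v) - below v V
    X-comparable v V chains-comparable chains-above = solve-for (begin
        1ℤ - X (filter (v ≶?_) V)
      ≡⟨ chains-comparable ⟩
        ∑ (filter (v ≶?_) V) (λ w → X (above (filter (v ≶?_) V) w))
      ≡⟨ ∑-filter (v ≶?_) V _ ⟩
        ∑ V (λ w → 𝟙 (v ≶? w) * X (above (filter (v ≶?_) V) w))
      ≡⟨ trans (∑-cong V (λ {w} _ → X-above-comparable v V w)) (∑-+ V _ _) ⟩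
        ∑ V (λ w → 𝟙 (v <? w) * X (above (above V v) w)) + below v V
      ≡⟨ cong (_+ below v V) (∑-filter (v <?_) V _) ⟨
        ∑ (above V v) (λ w → X (above (above V v) w)) + below v V
      ≡⟨ cong (_+ below v V) chains-above ⟨
        1ℤ - X (above V v) + below v V ∎)
      where
        open ≡-Reasoning
        solve-for : 1ℤ - X (filter (v ≶?_) V) ≡ 1ℤ - X (above V v) + below v V →
                    X (filter (v ≶?_) V) ≡ X (above V v) - below v V
        solve-for e = trans (double-negation _)
                            (trans (cong (_-_ 1ℤ) e) (cancel (X (above V v)) (below v V)))
          where
            double-negation : ∀ a → a ≡ 1ℤ - (1ℤ - a)
            double-negation = solve-∀
            cancel : ∀ b c → 1ℤ - (1ℤ - b + c) ≡ b - c
            cancel = solve-∀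

    chainsByMinimum-∷ : ∀ v V → ChainsByMinimum V → ChainsByMinimum (filter (v ≶?_) V) →
                        ChainsByMinimum (above V v) → ChainsByMinimum (v ∷ V)
    chainsByMinimum-∷ v V chains chains-comparable chains-above = begin
        1ℤ - X (v ∷ V)
      ≡⟨ cong (_-_ 1ℤ) (signedCliques-∷ _≶?_ v V) ⟩
        1ℤ - (X V - X (filter (v ≶?_) V))
      ≡⟨ cong (λ z → 1ℤ - (X V - z)) (X-comparable v V chains-comparable chains-above) ⟩
        1ℤ - (X V - (X (above V v) - below v V))
      ≡⟨ regroup (X V) (X (above V v)) (below v V) ⟩
        X (above V v) + ((1ℤ - X V) - below v V)
      ≡⟨ cong (λ z → X (above V v) + (z - below v V)) chains ⟩
        X (above V v) + (∑ V (λ w → X (above V w)) - below v V)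
      ≡⟨ cong (_+_ (X (above V v))) (∑-- V (λ w → X (above V w)) _) ⟨
        X (above V v) + ∑ V (λ w → X (above V w) - 𝟙 (w <? v) * X (filter (v ≶?_) (above V w)))
      ≡⟨ cong₂ _+_ (cong X (sym (filter-reject (v <?_) (<-irrefl refl))))
                   (∑-cong V (λ {w} _ → sym (X-above-∷ v V w))) ⟩
        ∑ (v ∷ V) (λ w → X (above (v ∷ V) w)) ∎
      where
        open ≡-Reasoning
        regroup : ∀ a b c → 1ℤ - (a - (b - c)) ≡ b + ((1ℤ - a) - c)
        regroup = solve-∀

    chainsByMinimum : ∀ k V → length V ≤ k → ChainsByMinimum V
    chainsByMinimum _       []      _           = refl
    chainsByMinimum (suc k) (v ∷ V) (s≤s |V|≤k) =
      chainsByMinimum-∷ v V (chainsByMinimum k V |V|≤k)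
        (chainsByMinimum k (filter (v ≶?_) V) (shorter (v ≶?_)))
        (chainsByMinimum k (above V v) (shorter (v <?_)))
      where
        shorter : ∀ {p} {P : Pred A p} (P? : U.Decidable P) → length (filter P? V) ≤ k
        shorter P? = ℕ.≤-trans (length-filter P? V) |V|≤k

  χ-by-minimum : ∀ V → χ _≶?_ V ≡ ∑ V (λ w → 1ℤ - χ _≶?_ (above V w))
  χ-by-minimum V = begin
      χ _≶?_ V                                 ≡⟨ χ≡1-signedCliques _≶?_ V ⟩
      1ℤ - X V                                 ≡⟨ chainsByMinimum (length V) V ℕ.≤-refl ⟩
      ∑ V (λ w → X (above V w))                ≡⟨ ∑-cong V (λ {w} _ → 1-χ (above V w)) ⟨
      ∑ V (λ w → 1ℤ - χ _≶?_ (above V w))      ∎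
    where
      open ≡-Reasoning
      double-negation : ∀ a → 1ℤ - (1ℤ - a) ≡ a
      double-negation = solve-∀
      1-χ : ∀ W → 1ℤ - χ _≶?_ W ≡ X W
      1-χ W = trans (cong (_-_ 1ℤ) (χ≡1-signedCliques _≶?_ W)) (double-negation (X W))

-- Inclusion–exclusion over the subsets of a set

subsets : ∀ {n} → Subset n → List (Subset n)
subsets []            = [] ∷ []
subsets (outside ∷ x) = map (outside ∷_) (subsets x)
subsets (inside ∷ x)  = map (outside ∷_) (subsets x) ++ map (inside ∷_) (subsets x)

∑-subsets-inside : ∀ {n} (x : Subset n) g →
  ∑ (subsets (inside ∷ x)) g
    ≡ ∑ (subsets x) (λ s → g (outside ∷ s)) + ∑ (subsets x) (λ s → g (inside ∷ s))
∑-subsets-inside x g =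
  trans (∑-++ (map (outside ∷_) (subsets x)) _ g)
        (cong₂ _+_ (∑-map (outside ∷_) (subsets x) g) (∑-map (inside ∷_) (subsets x) g))

∈-subsets⇒⊆ : ∀ {n} (x : Subset n) {s} → s ∈ subsets x → s ⊆ x
∈-subsets⇒⊆ []            (here refl) = λ ()
∈-subsets⇒⊆ (outside ∷ x) s∈          with ∈-map⁻ (outside ∷_) s∈
... | _ , s∈′ , refl = out⊆ (∈-subsets⇒⊆ x s∈′)
∈-subsets⇒⊆ (inside ∷ x)  s∈          with ∈-++⁻ (map (outside ∷_) (subsets x)) s∈
... | inj₁ s∈ˡ with ∈-map⁻ (outside ∷_) s∈ˡ
...   | _ , s∈′ , refl = out⊆ (∈-subsets⇒⊆ x s∈′)
∈-subsets⇒⊆ (inside ∷ x)  s∈ | inj₂ s∈ʳ with ∈-map⁻ (inside ∷_) s∈ʳ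
...   | _ , s∈′ , refl = s⊆s (∈-subsets⇒⊆ x s∈′)

sign : ∀ {n} → Subset n → ℤ
sign []            = 1ℤ
sign (outside ∷ s) = sign s
sign (inside ∷ s)  = - sign s

δ∅ : ∀ {n} → Subset n → ℤ
δ∅ []            = 1ℤ
δ∅ (outside ∷ s) = δ∅ s
δ∅ (inside ∷ s)  = 0ℤ

ε : ∀ {n} → Subset n → ℤ
ε s = δ∅ s - sign s

ε≡0⊎Nonempty : ∀ {n} (s : Subset n) → ε s ≡ 0ℤ ⊎ Nonempty s
ε≡0⊎Nonempty []            = inj₁ refl
ε≡0⊎Nonempty (inside ∷ s)  = inj₂ (zero , here)
ε≡0⊎Nonempty (outside ∷ s) with ε≡0⊎Nonempty s
... | inj₁ ε≡0         = inj₁ ε≡0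
... | inj₂ (i , i∈s)   = inj₂ (suc i , there i∈s)

𝟙-nonempty-outside : ∀ {n} (z : Subset n) → 𝟙 (nonempty? (outside ∷ z)) ≡ 𝟙 (nonempty? z)
𝟙-nonempty-outside z =
  𝟙-⇔ drop (λ (i , i∈z) → suc i , there i∈z) (nonempty? (outside ∷ z)) (nonempty? z)
  where
    drop : Nonempty (outside ∷ z) → Nonempty z
    drop (suc i , there i∈z) = i , i∈z

𝟙-nonempty-inside : ∀ {n} (z : Subset n) → 𝟙 (nonempty? (inside ∷ z)) ≡ 1ℤ
𝟙-nonempty-inside z = 𝟙≡1 (nonempty? (inside ∷ z)) (zero , here)

∑-subsets-sign : ∀ {n} (x y : Subset n) →
  ∑ (subsets x) (λ s → sign s * 𝟙 (s ⊆? y)) ≡ 1ℤ - 𝟙 (nonempty? (x ∩ y))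
∑-subsets-sign []            []            = refl
∑-subsets-sign (outside ∷ x) (_ ∷ y)       =
  trans (∑-map (outside ∷_) (subsets x) _)
        (trans (∑-subsets-sign x y) (cong (_-_ 1ℤ) (sym (𝟙-nonempty-outside (x ∩ y)))))
∑-subsets-sign (inside ∷ x)  (outside ∷ y) = begin
    ∑ (subsets (inside ∷ x)) (λ s → sign s * 𝟙 (s ⊆? outside ∷ y))
  ≡⟨ ∑-subsets-inside x _ ⟩
    ∑ (subsets x) (λ s → sign s * 𝟙 (s ⊆? y)) + ∑ (subsets x) (λ s → - sign s * 0ℤ)
  ≡⟨ cong₂ _+_ (∑-subsets-sign x y) (trans (∑-cong (subsets x) (λ {s} _ → ℤ.*-zeroʳ (- sign s)))
                                           (∑-zero (subsets x))) ⟩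
    1ℤ - 𝟙 (nonempty? (x ∩ y)) + 0ℤ
  ≡⟨ ℤ.+-identityʳ _ ⟩
    1ℤ - 𝟙 (nonempty? (x ∩ y))
  ≡⟨ cong (_-_ 1ℤ) (𝟙-nonempty-outside (x ∩ y)) ⟨
    1ℤ - 𝟙 (nonempty? (outside ∷ (x ∩ y))) ∎
  where open ≡-Reasoning
∑-subsets-sign (inside ∷ x)  (inside ∷ y)  = begin
    ∑ (subsets (inside ∷ x)) (λ s → sign s * 𝟙 (s ⊆? inside ∷ y))
  ≡⟨ ∑-subsets-inside x _ ⟩
    ∑ (subsets x) (λ s → sign s * 𝟙 (s ⊆? y)) + ∑ (subsets x) (λ s → - sign s * 𝟙 (s ⊆? y))
  ≡⟨ cong (_+_ σ) (trans (∑-cong (subsets x) (λ {s} _ → sym (ℤ.neg-distribˡ-* (sign s) (𝟙 (s ⊆? y)))))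
                         (∑-neg (subsets x) (λ s → sign s * 𝟙 (s ⊆? y)))) ⟩
    σ - σ
  ≡⟨ ℤ.+-inverseʳ σ ⟩
    0ℤ
  ≡⟨ cong (_-_ 1ℤ) (𝟙-nonempty-inside (x ∩ y)) ⟨
    1ℤ - 𝟙 (nonempty? (inside ∷ (x ∩ y))) ∎
  where
    open ≡-Reasoning
    σ : ℤ
    σ = ∑ (subsets x) (λ s → sign s * 𝟙 (s ⊆? y))

∑-subsets-δ∅ : ∀ {n} (x y : Subset n) → ∑ (subsets x) (λ s → δ∅ s * 𝟙 (s ⊆? y)) ≡ 1ℤ
∑-subsets-δ∅ []            []      = refl
∑-subsets-δ∅ (outside ∷ x) (_ ∷ y) = trans (∑-map (outside ∷_) (subsets x) _) (∑-subsets-δ∅ x y)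
∑-subsets-δ∅ (inside ∷ x)  (_ ∷ y) =
  trans (∑-subsets-inside x _)
        (trans (cong₂ _+_ (∑-subsets-δ∅ x y) (∑-zero (subsets x))) (ℤ.+-identityʳ 1ℤ))

∑-subsets-ε : ∀ {n} (x y : Subset n) →
  ∑ (subsets x) (λ s → ε s * 𝟙 (s ⊆? y)) ≡ 𝟙 (nonempty? (x ∩ y))
∑-subsets-ε x y = begin
    ∑ (subsets x) (λ s → ε s * 𝟙 (s ⊆? y))
  ≡⟨ ∑-cong (subsets x) (λ {s} _ → distrib (δ∅ s) (sign s) (𝟙 (s ⊆? y))) ⟩
    ∑ (subsets x) (λ s → δ∅ s * 𝟙 (s ⊆? y) - sign s * 𝟙 (s ⊆? y))
  ≡⟨ ∑-- (subsets x) _ _ ⟩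
    ∑ (subsets x) (λ s → δ∅ s * 𝟙 (s ⊆? y)) - ∑ (subsets x) (λ s → sign s * 𝟙 (s ⊆? y))
  ≡⟨ cong₂ _-_ (∑-subsets-δ∅ x y) (∑-subsets-sign x y) ⟩
    1ℤ - (1ℤ - 𝟙 (nonempty? (x ∩ y)))
  ≡⟨ double-negation (𝟙 (nonempty? (x ∩ y))) ⟩
    𝟙 (nonempty? (x ∩ y)) ∎
  where
    open ≡-Reasoning
    distrib : ∀ a b i → (a - b) * i ≡ a * i - b * i
    distrib = solve-∀
    double-negation : ∀ a → 1ℤ - (1ℤ - a) ≡ a
    double-negation = solve-∀

∑-meeting : ∀ {n} (L : List (Subset n)) x (g : Subset n → ℤ) →
  ∑ L (λ y → 𝟙 (nonempty? (x ∩ y)) * g y)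
    ≡ ∑ (subsets x) (λ s → ε s * ∑ L (λ y → 𝟙 (s ⊆? y) * g y))
∑-meeting L x g = begin
    ∑ L (λ y → 𝟙 (nonempty? (x ∩ y)) * g y)
  ≡⟨ ∑-cong L (λ {y} _ → cong (_* g y) (∑-subsets-ε x y)) ⟨
    ∑ L (λ y → ∑ (subsets x) (λ s → ε s * 𝟙 (s ⊆? y)) * g y)
  ≡⟨ ∑-cong L (λ {y} _ → trans (∑-*ʳ (subsets x) (λ s → ε s * 𝟙 (s ⊆? y)) (g y))
                                (∑-cong (subsets x) (λ {s} _ → ℤ.*-assoc (ε s) (𝟙 (s ⊆? y)) (g y)))) ⟩
    ∑ L (λ y → ∑ (subsets x) (λ s → ε s * (𝟙 (s ⊆? y) * g y)))
  ≡⟨ ∑-comm L (subsets x) (λ y s → ε s * (𝟙 (s ⊆? y) * g y)) ⟩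
    ∑ (subsets x) (λ s → ∑ L (λ y → ε s * (𝟙 (s ⊆? y) * g y)))
  ≡⟨ ∑-cong (subsets x) (λ {s} _ → ∑-*ˡ L (ε s) (λ y → 𝟙 (s ⊆? y) * g y)) ⟩
    ∑ (subsets x) (λ s → ε s * ∑ L (λ y → 𝟙 (s ⊆? y) * g y)) ∎
  where open ≡-Reasoning

meets-self : ∀ {n} {x : Subset n} → Nonempty x → 𝟙 (nonempty? (x ∩ x)) ≡ 1ℤ
meets-self {x = x} x≢∅ = 𝟙≡1 (nonempty? (x ∩ x)) (subst Nonempty (sym (∩-idem x)) x≢∅)

∑-subsets-ε≡1 : ∀ {n} {x : Subset n} → Nonempty x → ∑ (subsets x) ε ≡ 1ℤ
∑-subsets-ε≡1 {x = x} x≢∅ = begin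
    ∑ (subsets x) ε
  ≡⟨ ∑-cong (subsets x) (λ {s} s∈ → trans (sym (ℤ.*-identityʳ (ε s)))
                                          (cong (ε s *_) (sym (𝟙≡1 (s ⊆? x) (∈-subsets⇒⊆ x s∈))))) ⟩
    ∑ (subsets x) (λ s → ε s * 𝟙 (s ⊆? x))
  ≡⟨ ∑-subsets-ε x x ⟩
    𝟙 (nonempty? (x ∩ x))
  ≡⟨ meets-self x≢∅ ⟩
    1ℤ ∎
  where open ≡-Reasoning

𝟙-⊆? : ∀ {n} (s y : Subset n) → 𝟙 (s ⊆? y) ≡ 𝟙 (s ≟ˢ y) + 𝟙 (s ⊂? y)
𝟙-⊆? []            []            = refl
𝟙-⊆? (outside ∷ s) (outside ∷ y) = 𝟙-⊆? s y
𝟙-⊆? (outside ∷ s) (inside ∷ y)  = sym (ℤ.+-identityˡ _)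
𝟙-⊆? (inside ∷ s)  (outside ∷ y) = refl
𝟙-⊆? (inside ∷ s)  (inside ∷ y)  = 𝟙-⊆? s y

module _ {n : ℕ} (G : Complex n) where

  private
    F : List (Subset n)
    F = faces G

  open OrderComplex (⊂-isStrictPartialOrder n) _⊂?_ using (above; above-above; χ-by-minimum)

  χS⁺-recursion : ∀ y → χS⁺ G y ≡ ∑ F (λ w → 𝟙 (y ⊂? w) * (1ℤ - χS⁺ G w))
  χS⁺-recursion y = begin
      χS⁺ G y
    ≡⟨ χ-by-minimum (starVerts G y) ⟩
      ∑ (starVerts G y) (λ w → 1ℤ - χ comparable? (above (starVerts G y) w))
    ≡⟨ ∑-filter (y ⊂?_) F _ ⟩
      ∑ F (λ w → 𝟙 (y ⊂? w) * (1ℤ - χ comparable? (above (starVerts G y) w)))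
    ≡⟨ ∑-cong F (λ {w} _ → 𝟙*-cong (y ⊂? w) (λ y⊂w →
         cong (λ W → 1ℤ - χ comparable? W) (above-above y⊂w F))) ⟩
      ∑ F (λ w → 𝟙 (y ⊂? w) * (1ℤ - χS⁺ G w)) ∎
    where open ≡-Reasoning

  cofaces : Subset n → ℤ
  cofaces s = ∑ F (λ y → 𝟙 (s ⊂? y) * 1ℤ)

  ∑-⊇-split : ∀ {s} → s ∈ F → ∀ g →
    ∑ F (λ y → 𝟙 (s ⊆? y) * g y) ≡ g s + ∑ F (λ y → 𝟙 (s ⊂? y) * g y)
  ∑-⊇-split {s} s∈G g =
    trans (∑-cong F (λ {y} _ → trans (cong (_* g y) (𝟙-⊆? s y))
                                     (ℤ.*-distribʳ-+ (g y) (𝟙 (s ≟ˢ y)) (𝟙 (s ⊂? y)))))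
          (trans (∑-+ F _ _)
                 (cong (_+ ∑ F (λ y → 𝟙 (s ⊂? y) * g y)) (∑-sift _≟ˢ_ (unique G) s∈G g)))

  ∑-⊇-χS⁺ : ∀ {s} → s ∈ F → ∑ F (λ y → 𝟙 (s ⊆? y) * χS⁺ G y) ≡ cofaces s
  ∑-⊇-χS⁺ {s} s∈G = begin
      ∑ F (λ y → 𝟙 (s ⊆? y) * χS⁺ G y)
    ≡⟨ ∑-⊇-split s∈G (χS⁺ G) ⟩
      χS⁺ G s + ∑ F (λ y → 𝟙 (s ⊂? y) * χS⁺ G y)
    ≡⟨ cong (_+ ∑ F (λ y → 𝟙 (s ⊂? y) * χS⁺ G y)) (χS⁺-recursion s) ⟩
      ∑ F (λ y → 𝟙 (s ⊂? y) * (1ℤ - χS⁺ G y)) + ∑ F (λ y → 𝟙 (s ⊂? y) * χS⁺ G y)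
    ≡⟨ ∑-+ F _ _ ⟨
      ∑ F (λ y → 𝟙 (s ⊂? y) * (1ℤ - χS⁺ G y) + 𝟙 (s ⊂? y) * χS⁺ G y)
    ≡⟨ ∑-cong F (λ {y} _ → telescope (𝟙 (s ⊂? y)) (χS⁺ G y)) ⟩
      cofaces s ∎
    where
      open ≡-Reasoning
      telescope : ∀ a b → a * (1ℤ - b) + a * b ≡ a * 1ℤ
      telescope = solve-∀

  ∑-⊇-one : ∀ {s} → s ∈ F → ∑ F (λ y → 𝟙 (s ⊆? y) * 1ℤ) ≡ 1ℤ + cofaces s
  ∑-⊇-one s∈G = ∑-⊇-split s∈G (λ _ → 1ℤ)

  -- The empty set has weight ε ∅ = 0, and every other subset of a face is a face.
  ∑-subsets-face-cong : ∀ {x} → x ∈ F → {a b : Subset n → ℤ} → (∀ {s} → s ∈ F → a s ≡ b s) →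
    ∑ (subsets x) (λ s → ε s * a s) ≡ ∑ (subsets x) (λ s → ε s * b s)
  ∑-subsets-face-cong {x} x∈G {a} {b} a≡b = ∑-cong (subsets x) pointwise
    where
      pointwise : ∀ {s} → s ∈ subsets x → ε s * a s ≡ ε s * b s
      pointwise {s} s∈ with ε≡0⊎Nonempty s
      ... | inj₁ ε≡0 = trans (cong (_* a s) ε≡0) (sym (cong (_* b s) ε≡0))
      ... | inj₂ s≢∅ = cong (ε s *_) (a≡b (closed G x∈G s≢∅ (∈-subsets⇒⊆ x s∈)))

  ∑-ball' : ∀ {x} → Nonempty x → ∀ g →
    ∑ (ball' G x) g ≡ ∑ F (λ y → 𝟙 (nonempty? (x ∩ y)) * g y)
  ∑-ball' {x} x≢∅ g =
    trans (∑-filter _ F g) (∑-cong F (λ {y} _ → cong (_* g y) (𝟙-ball y)))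
    where
      𝟙-ball : ∀ y → 𝟙 ((y ≟ˢ x) ⊎-dec connected? x y) ≡ 𝟙 (nonempty? (x ∩ y))
      𝟙-ball y with y ≟ˢ x
      ... | yes refl = sym (meets-self x≢∅)
      ... | no y≢x   = 𝟙-⇔ (λ { (inj₁ y≡x) → contradiction y≡x y≢x
                              ; (inj₂ (_ , x∩y≢∅)) → x∩y≢∅ })
                           (λ x∩y≢∅ → inj₂ ((λ x≡y → y≢x (sym x≡y)) , x∩y≢∅))
                           (no y≢x ⊎-dec connected? x y) (nonempty? (x ∩ y))

  degree'≡meets-1 : ∀ {x} → x ∈ F →
    + degree' G x ≡ ∑ F (λ y → 𝟙 (nonempty? (x ∩ y)) * 1ℤ) - 1ℤ
  degree'≡meets-1 {x} x∈G = begin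
      + degree' G x
    ≡⟨ length-filter≡∑ (connected? x) F ⟩
      ∑ F (λ y → 𝟙 (connected? x y))
    ≡⟨ ∑-cong F (λ {y} _ → 𝟙-connected y) ⟩
      ∑ F (λ y → 𝟙 (nonempty? (x ∩ y)) * 1ℤ - 𝟙 (x ≟ˢ y) * 1ℤ)
    ≡⟨ ∑-- F _ _ ⟩
      ∑ F (λ y → 𝟙 (nonempty? (x ∩ y)) * 1ℤ) - ∑ F (λ y → 𝟙 (x ≟ˢ y) * 1ℤ)
    ≡⟨ cong (_-_ (∑ F (λ y → 𝟙 (nonempty? (x ∩ y)) * 1ℤ)))
            (∑-sift _≟ˢ_ (unique G) x∈G (λ _ → 1ℤ)) ⟩
      ∑ F (λ y → 𝟙 (nonempty? (x ∩ y)) * 1ℤ) - 1ℤ ∎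
    where
      open ≡-Reasoning
      𝟙-connected : ∀ y → 𝟙 (connected? x y) ≡ 𝟙 (nonempty? (x ∩ y)) * 1ℤ - 𝟙 (x ≟ˢ y) * 1ℤ
      𝟙-connected y with x ≟ˢ y
      ... | yes refl = sym (cong (λ m → m * 1ℤ - 1ℤ) (meets-self (lookup (nonempty G) x∈G)))
      ... | no _     = sym (trans (ℤ.+-identityʳ _) (ℤ.*-identityʳ _))

lemma1 : ∀ {n : ℕ} (G : Complex n) (x : Subset n) → x ∈ faces G →
    + degree' G x ≡ sumℤ (map (χS⁺ G) (ball' G x))
lemma1 {n} G x x∈G = begin
    + degree' G x
  ≡⟨ degree'≡meets-1 G x∈G ⟩
    ∑ F (λ y → 𝟙 (nonempty? (x ∩ y)) * 1ℤ) - 1ℤ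
  ≡⟨ cong (_- 1ℤ) (∑-meeting F x (λ _ → 1ℤ)) ⟩
    ∑ (subsets x) (λ s → ε s * ∑ F (λ y → 𝟙 (s ⊆? y) * 1ℤ)) - 1ℤ
  ≡⟨ cong (_- 1ℤ) (∑-subsets-face-cong G x∈G (∑-⊇-one G)) ⟩
    ∑ (subsets x) (λ s → ε s * (1ℤ + cofaces G s)) - 1ℤ
  ≡⟨ cong (_- 1ℤ) ∑-ε-1+cofaces ⟩
    1ℤ + T - 1ℤ
  ≡⟨ cancel T ⟩
    T
  ≡⟨ ∑-subsets-face-cong G x∈G (∑-⊇-χS⁺ G) ⟨
    ∑ (subsets x) (λ s → ε s * ∑ F (λ y → 𝟙 (s ⊆? y) * χS⁺ G y))
  ≡⟨ ∑-meeting F x (χS⁺ G) ⟨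
    ∑ F (λ y → 𝟙 (nonempty? (x ∩ y)) * χS⁺ G y)
  ≡⟨ ∑-ball' G (lookup (nonempty G) x∈G) (χS⁺ G) ⟨
    ∑ (ball' G x) (χS⁺ G) ∎
  where
    open ≡-Reasoning
    F : List (Subset n)
    F = faces G
    T : ℤ
    T = ∑ (subsets x) (λ s → ε s * cofaces G s)
    cancel : ∀ t → 1ℤ + t - 1ℤ ≡ t
    cancel = solve-∀
    ∑-ε-1+cofaces : ∑ (subsets x) (λ s → ε s * (1ℤ + cofaces G s)) ≡ 1ℤ + T
    ∑-ε-1+cofaces =
      trans (∑-cong (subsets x) (λ {s} _ → trans (ℤ.*-distribˡ-+ (ε s) 1ℤ (cofaces G s))
                                                 (cong (_+ ε s * cofaces G s) (ℤ.*-identityʳ (ε s)))))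
            (trans (∑-+ (subsets x) ε _) (cong (_+ T) (∑-subsets-ε≡1 (lookup (nonempty G) x∈G))))
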